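{- Let $G$ be a finite abelian group and let $f$ be an automorphism of the monoid $\mathcal{P}_{0}(G)$ with pullback $g$. Then for every nonzero $a\in G$ and every $n\in\mathbb{N}$ we have $\operatorname{ord}(a)=\operatorname{ord}(g(a))$ and $g(na)=n\,g(a)$.
   Context: For an additively written finite abelian group $G$, $\mathcal{P}_{0}(G)$ denotes the reduced power monoid of $G$: the set of all subsets of $G$ containing $0$, with setwise addition $X+Y=\{x+y : x\in X, y\in Y\}$ and identity $\{0\}$. Every automorphism $f$ of $\mathcal{P}_{0}(G)$ maps $2$-element sets to $2$-element sets; the pullback of $f$ is the bijection $g:G\to G$ defined by $g(0)=0$ and, for nonzero $a\in G$, by $f(\{0,a\})=\{0,g(a)\}$. $\mathbb{N}$ is the set of positive integers. -}

module Defs where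

open import Level using (0ℓ)
open import Data.Nat using (ℕ; zero; suc; _<_)
open import Data.Fin using (Fin)
open import Data.Fin.Properties using (_≟_; any?)
open import Data.Fin.Subset using (Subset; _∈_; ⁅_⁆; _∪_)
open import Data.Fin.Subset.Properties using (_∈?_)
import Data.Fin.Subset.Properties
import Data.Sum
import Function.Bundles
import Data.Bool.Properties
open import Data.Vec using (tabulate; lookup)
open import Data.Vec.Properties using (lookup⇒[]=; lookup∘tabulate)
open import Data.Product using (Σ; _×_; _,_; proj₁)
open import Relation.Nullary using (¬_)
open import Relation.Nullary.Decidable using (⌊_⌋; _×-dec_; fromWitness)
open import Relation.Binary.PropositionalEquality using (_≡_; _≢_; trans)
open import Algebra.Structures using (IsAbelianGroup)

-- A finite abelian group, presented (up to isomorphism) on the carrier Fin card,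
-- with propositional equality.
record FinAbGroup : Set where
  field
    card    : ℕ
    _⊕_     : Fin card → Fin card → Fin card
    e       : Fin card
    ⊖_      : Fin card → Fin card
    isAbGrp : IsAbelianGroup _≡_ _⊕_ e ⊖_

  open IsAbelianGroup isAbGrp public using (identityˡ)

module _ (G : FinAbGroup) where
  open FinAbGroup G

  mul : ℕ → Fin card → Fin card
  mul zero    a = e
  mul (suc m) a = a ⊕ mul m a

  IsOrder : Fin card → ℕ → Set
  IsOrder a m = (0 < m) × (mul m a ≡ e) × (∀ k → 0 < k → k < m → mul k a ≢ e)

  -- setwise sum X + Y = { x + y | x ∈ X, y ∈ Y }
  _⊞_ : Subset card → Subset card → Subset card
  X ⊞ Y = tabulate (λ z → ⌊ any? (λ x → any? (λ y → (x ∈? X) ×-dec ((y ∈? Y) ×-dec ((x ⊕ y) ≟ z)))) ⌋)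

  P₀ : Set
  P₀ = Σ (Subset card) (λ X → e ∈ X)

  ⊞-closed : (X Y : P₀) → e ∈ (proj₁ X ⊞ proj₁ Y)
  ⊞-closed (X , eX) (Y , eY) =
    lookup⇒[]= e _ (trans (lookup∘tabulate _ e)
      (Function.Bundles.Equivalence.to Data.Bool.Properties.T-≡ (fromWitness (e , e , eX , eY , identityˡ e))))

  _+P_ : P₀ → P₀ → P₀
  X +P Y = (proj₁ X ⊞ proj₁ Y) , ⊞-closed X Y

  zeroP : P₀
  zeroP = ⁅ e ⁆ , Data.Fin.Subset.Properties.x∈⁅x⁆ e

  pair : Fin card → P₀
  pair a = (⁅ e ⁆ ∪ ⁅ a ⁆) , Data.Fin.Subset.Properties.x∈p∪q⁺ (Data.Sum.inj₁ (Data.Fin.Subset.Properties.x∈⁅x⁆ e))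

  _≈P_ : P₀ → P₀ → Set
  X ≈P Y = proj₁ X ≡ proj₁ Y

  record IsAutomorphism (f : P₀ → P₀) : Set where
    field
      hom    : ∀ X Y → f (X +P Y) ≈P (f X +P f Y)
      unit   : f zeroP ≈P zeroP
      inv    : P₀ → P₀
      inv-l  : ∀ X → inv (f X) ≈P X
      inv-r  : ∀ X → f (inv X) ≈P X

  IsPullback : (P₀ → P₀) → (Fin card → Fin card) → Set
  IsPullback f g = (g e ≡ e) × (∀ a → a ≢ e → f (pair a) ≈P pair (g a))

module Submission where

open import Defs
open import Data.Nat using (ℕ; zero; suc; _<_; _≤_; _+_; _∸_; z≤n; s≤s; _≤?_)
open import Data.Nat.Properties
  using (≤-refl; ≤-trans; ≤-reflexive; ≤-antisym; ≰⇒>; m≤n⇒m≤1+n; m∸n≤m; ∸-monoˡ-≤; +-mono-≤;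
         m+[n∸m]≡n; m∸n+n≡m; m+n∸n≡m; m∸[m∸n]≡n)
open import Data.Fin using (Fin)
open import Data.Fin.Properties using (any?; _≟_)
open import Data.Fin.Subset using (_∈_; ⁅_⁆; _⊆_)
open import Data.Fin.Subset.Properties using (x∈⁅x⁆; x∈⁅y⁆⇒x≡y; x∈p∪q⁻; x∈p∪q⁺; ⊆-antisym; ∪-idem; _∈?_)
open import Data.Vec.Properties using (lookup⇒[]=; []=⇒lookup; lookup∘tabulate)
open import Data.Vec.Properties.WithK using ([]=-irrelevant)
open import Data.Product using (Σ; _×_; _,_; proj₁; proj₂)
open import Data.Sum as Sum using (_⊎_; inj₁; inj₂)
open import Relation.Nullary using (yes; no)
open import Relation.Nullary.Decidable using (toWitness; fromWitness; _×-dec_)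
open import Relation.Binary.PropositionalEquality
open import Algebra.Structures using (IsAbelianGroup)
open import Algebra.Bundles using (Group)
import Algebra.Properties.Group as GroupProperties
open import Level using (0ℓ)
open import Data.Bool.Properties using (T-≡)
open import Function.Bundles using (module Equivalence)

-- Write Sₙ(x) (multiples x n) = {0, x, …, n·x} = {0,x} + ⋯ + {0,x}, so f(Sₙ(a)) = Sₙ(g a).  Applying f to
-- Sₙ(a) + {0, (n+1)·a} = Sₙ(a) + Sₙ₊₁(a) shows that (n+1)·g(a) is j·g(a) or j·g(a) + g((n+1)·a)
-- for some j ≤ n.  By strong induction g(k·a) = k·g(a) for k ≤ n, so (g being injective with
-- g(0) = 0) a and g(a) have the same vanishing multiples below n + 1; a coincidence
-- (n+1)·x = i·x is such a vanishing, of (n+1-i)·x, and transfers between a and g(a), which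
-- settles both cases.  Equal vanishing multiples then give equal orders.

module Multiples (G : FinAbGroup) where
  open FinAbGroup G
  open IsAbelianGroup isAbGrp using (assoc; comm; identityʳ)

  infixr 25 _·_
  _·_ : ℕ → Fin card → Fin card
  _·_ = mul G

  group : Group 0ℓ 0ℓ
  group = record { isGroup = IsAbelianGroup.isGroup isAbGrp }

  open GroupProperties group using (∙-cancelˡ)

  ·-distribʳ-+ : ∀ i j x → (i + j) · x ≡ i · x ⊕ j · x
  ·-distribʳ-+ zero    j x = sym (identityˡ _)
  ·-distribʳ-+ (suc i) j x = trans (cong (x ⊕_) (·-distribʳ-+ i j x)) (sym (assoc _ _ _))

  ·-split : ∀ x {i n} → i ≤ n → n · x ≡ i · x ⊕ (n ∸ i) · x
  ·-split x {i} {n} i≤n = trans (cong (_· x) (sym (m+[n∸m]≡n i≤n))) (·-distribʳ-+ i (n ∸ i) x)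

  ·-≡⇒∸-zero : ∀ x {i n} → i ≤ n → n · x ≡ i · x → (n ∸ i) · x ≡ e
  ·-≡⇒∸-zero x {i} i≤n eq = ∙-cancelˡ (i · x) _ _ (trans (sym (·-split x i≤n)) (trans eq (sym (identityʳ _))))

  ∸-zero⇒·-≡ : ∀ x {i n} → i ≤ n → (n ∸ i) · x ≡ e → n · x ≡ i · x
  ∸-zero⇒·-≡ x {i} i≤n eq = trans (·-split x i≤n) (trans (cong (i · x ⊕_) eq) (identityʳ _))

  ·-≡-transfer : ∀ {x y i n} → i ≤ n → ((n ∸ i) · x ≡ e → (n ∸ i) · y ≡ e) →
                 n · x ≡ i · x → n · y ≡ i · y
  ·-≡-transfer {x} {y} i≤n zeros eq = ∸-zero⇒·-≡ y i≤n (zeros (·-≡⇒∸-zero x i≤n eq))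

  IsOrder-transfer : ∀ {x y m} → (∀ k → k · x ≡ e → k · y ≡ e) → (∀ k → k · y ≡ e → k · x ≡ e) →
                     IsOrder G x m → IsOrder G y m
  IsOrder-transfer {m = m} to from (0<m , mx≡e , minimal) =
    0<m , to m mx≡e , λ k 0<k k<m ky≡e → minimal k 0<k k<m (from k ky≡e)

  infixl 6 _+ᴾ_
  _+ᴾ_ : P₀ G → P₀ G → P₀ G
  _+ᴾ_ = _+P_ G

  ≈P⇒≡ : ∀ {X Y} → _≈P_ G X Y → X ≡ Y
  ≈P⇒≡ {X , p} {.X , q} refl = cong (X ,_) ([]=-irrelevant p q)

  ∈-+ᴾ⁻ : ∀ X Y {z} → z ∈ proj₁ (X +ᴾ Y) →
          Σ (Fin card) λ x → Σ (Fin card) λ y → x ∈ proj₁ X × y ∈ proj₁ Y × x ⊕ y ≡ z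
  ∈-+ᴾ⁻ (X , _) (Y , _) {z} z∈X+Y =
    toWitness {a? = any? (λ x → any? (λ y → (x ∈? X) ×-dec ((y ∈? Y) ×-dec ((x ⊕ y) ≟ z))))}
      (Equivalence.from T-≡ (trans (sym (lookup∘tabulate _ z)) ([]=⇒lookup z∈X+Y)))

  ∈-+ᴾ⁺ : ∀ X Y {x y z} → x ∈ proj₁ X → y ∈ proj₁ Y → x ⊕ y ≡ z → z ∈ proj₁ (X +ᴾ Y)
  ∈-+ᴾ⁺ _ _ {x} {y} {z} x∈X y∈Y x⊕y≡z =
    lookup⇒[]= z _ (trans (lookup∘tabulate _ z) (Equivalence.to T-≡ (fromWitness (x , y , x∈X , y∈Y , x⊕y≡z))))

  ∈-pair⁻ : ∀ {x z} → z ∈ proj₁ (pair G x) → z ≡ e ⊎ z ≡ x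
  ∈-pair⁻ {x} z∈ = Sum.map (x∈⁅y⁆⇒x≡y e) (x∈⁅y⁆⇒x≡y x) (x∈p∪q⁻ ⁅ e ⁆ ⁅ x ⁆ z∈)

  x∈pair : ∀ x → x ∈ proj₁ (pair G x)
  x∈pair x = x∈p∪q⁺ (inj₂ (x∈⁅x⁆ x))

  pair-injective : ∀ {x y} → pair G x ≡ pair G y → x ≡ y
  pair-injective {x} {y} pairs≡ with ∈-pair⁻ (subst (λ Z → x ∈ proj₁ Z) pairs≡ (x∈pair x))
  ... | inj₂ x≡y = x≡y
  ... | inj₁ refl with ∈-pair⁻ (subst (λ Z → y ∈ proj₁ Z) (sym pairs≡) (x∈pair y))
  ...   | inj₁ y≡e = sym y≡e
  ...   | inj₂ y≡e = sym y≡e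

  pair-e : pair G e ≡ zeroP G
  pair-e = ≈P⇒≡ (∪-idem ⁅ e ⁆)

  multiples : Fin card → ℕ → P₀ G
  multiples x zero    = zeroP G
  multiples x (suc n) = multiples x n +ᴾ pair G x

  ∈-multiples⁻ : ∀ x n {z} → z ∈ proj₁ (multiples x n) → Σ ℕ λ i → i ≤ n × z ≡ i · x
  ∈-multiples⁻ x zero    z∈ = 0 , z≤n , x∈⁅y⁆⇒x≡y e z∈
  ∈-multiples⁻ x (suc n) z∈ with ∈-+ᴾ⁻ (multiples x n) (pair G x) z∈
  ... | u , v , u∈ , v∈ , u⊕v≡z with ∈-multiples⁻ x n u∈ | ∈-pair⁻ v∈
  ... | i , i≤n , refl | inj₁ refl = i , m≤n⇒m≤1+n i≤n , trans (sym u⊕v≡z) (identityʳ _)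
  ... | i , i≤n , refl | inj₂ refl = suc i , s≤s i≤n , trans (sym u⊕v≡z) (comm _ _)

  ∈-multiples⁺ : ∀ x {i n} → i ≤ n → i · x ∈ proj₁ (multiples x n)
  ∈-multiples⁺ x {zero}  {n}     _         = proj₂ (multiples x n)
  ∈-multiples⁺ x {suc i} {suc n} (s≤s i≤n) =
    ∈-+ᴾ⁺ (multiples x n) (pair G x) (∈-multiples⁺ x i≤n) (x∈pair x) (comm (i · x) x)

  multiples-stable : ∀ x n → suc n · x ∈ proj₁ (multiples x n) → multiples x (suc n) ≡ multiples x n
  multiples-stable x n sucn·x∈ = ≈P⇒≡ (⊆-antisym shrink grow)
    where
    shrink : proj₁ (multiples x (suc n)) ⊆ proj₁ (multiples x n)
    shrink z∈ with ∈-multiples⁻ x (suc n) z∈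
    ... | i , i≤1+n , refl with i ≤? n
    ... | yes i≤n = ∈-multiples⁺ x i≤n
    ... | no  i≰n rewrite ≤-antisym i≤1+n (≰⇒> i≰n) = sucn·x∈
    grow : proj₁ (multiples x n) ⊆ proj₁ (multiples x (suc n))
    grow z∈ = ∈-+ᴾ⁺ (multiples x n) (pair G x) z∈ (proj₂ (pair G x)) (identityʳ _)

  -- Every i·x + j·x with i ≤ n, j ≤ n + 1 is either (i+j)·x with i + j ≤ n, or
  -- (i+j-(n+1))·x + (n+1)·x.
  multiples+pair-next : ∀ x n → multiples x n +ᴾ pair G (suc n · x) ≡ multiples x n +ᴾ multiples x (suc n)
  multiples+pair-next x n = ≈P⇒≡ (⊆-antisym ⊆-left ⊆-right)
    where
    ⊆-left : proj₁ (multiples x n +ᴾ pair G (suc n · x)) ⊆ proj₁ (multiples x n +ᴾ multiples x (suc n))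
    ⊆-left z∈ with ∈-+ᴾ⁻ (multiples x n) (pair G (suc n · x)) z∈
    ... | u , v , u∈ , v∈ , u⊕v≡z with ∈-pair⁻ v∈
    ... | inj₁ refl = ∈-+ᴾ⁺ (multiples x n) (multiples x (suc n)) u∈ (proj₂ (multiples x (suc n))) u⊕v≡z
    ... | inj₂ refl = ∈-+ᴾ⁺ (multiples x n) (multiples x (suc n)) u∈ (∈-multiples⁺ x (≤-refl {suc n})) u⊕v≡z
    ⊆-right : proj₁ (multiples x n +ᴾ multiples x (suc n)) ⊆ proj₁ (multiples x n +ᴾ pair G (suc n · x))
    ⊆-right z∈ with ∈-+ᴾ⁻ (multiples x n) (multiples x (suc n)) z∈
    ... | u , v , u∈ , v∈ , u⊕v≡z with ∈-multiples⁻ x n u∈ | ∈-multiples⁻ x (suc n) v∈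
    ... | i , i≤n , refl | j , j≤1+n , refl with i + j ≤? n
    ... | yes i+j≤n = ∈-+ᴾ⁺ (multiples x n) (pair G (suc n · x)) (∈-multiples⁺ x i+j≤n) (proj₂ (pair G _))
                        (trans (identityʳ _) (trans (·-distribʳ-+ i j x) u⊕v≡z))
    ... | no  i+j≰n = ∈-+ᴾ⁺ (multiples x n) (pair G (suc n · x)) (∈-multiples⁺ x t≤n) (x∈pair _)
                        (trans (sym (·-distribʳ-+ t (suc n) x))
                          (trans (cong (_· x) (m∸n+n≡m (≰⇒> i+j≰n))) (trans (·-distribʳ-+ i j x) u⊕v≡z)))
      where
      t : ℕ
      t = i + j ∸ suc n
      t≤n : t ≤ n
      t≤n = ≤-trans (∸-monoˡ-≤ (suc n) (+-mono-≤ i≤n j≤1+n)) (≤-reflexive (m+n∸n≡m n (suc n)))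

module Pullback (G : FinAbGroup) (f : P₀ G → P₀ G) (aut : IsAutomorphism G f)
                (g : Fin (FinAbGroup.card G) → Fin (FinAbGroup.card G)) (pb : IsPullback G f g) where
  open FinAbGroup G
  open IsAbelianGroup isAbGrp using (identityʳ)
  open IsAutomorphism aut
  open Multiples G
  open GroupProperties group using (∙-cancelˡ)

  g-e : g e ≡ e
  g-e = proj₁ pb

  f-hom : ∀ X Y → f (X +ᴾ Y) ≡ f X +ᴾ f Y
  f-hom X Y = ≈P⇒≡ (hom X Y)

  f-injective : ∀ {X Y} → f X ≡ f Y → X ≡ Y
  f-injective {X} {Y} fX≡fY = ≈P⇒≡ (trans (sym (inv-l X)) (trans (cong (λ Z → proj₁ (inv Z)) fX≡fY) (inv-l Y)))

  f-pair : ∀ x → f (pair G x) ≡ pair G (g x)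
  f-pair x with x ≟ e
  ... | yes refl = trans (cong f pair-e) (trans (≈P⇒≡ unit) (trans (sym pair-e) (cong (pair G) (sym g-e))))
  ... | no  x≢e  = ≈P⇒≡ (proj₂ pb x x≢e)

  f-multiples : ∀ x n → f (multiples x n) ≡ multiples (g x) n
  f-multiples x zero    = ≈P⇒≡ unit
  f-multiples x (suc n) = trans (f-hom _ _) (cong₂ _+ᴾ_ (f-multiples x n) (f-pair x))

  g-injective : ∀ {x y} → g x ≡ g y → x ≡ y
  g-injective {x} {y} gx≡gy =
    pair-injective (f-injective (trans (f-pair x) (trans (cong (pair G) gx≡gy) (sym (f-pair y)))))

  g-zero⁺ : ∀ {x} → x ≡ e → g x ≡ e
  g-zero⁺ refl = g-e

  g-zero⁻ : ∀ {x} → g x ≡ e → x ≡ e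
  g-zero⁻ gx≡e = g-injective (trans gx≡e (sym g-e))

  module _ (a : Fin card) where
    private
      b : Fin card
      b = g a

    module _ (n : ℕ) (ih : ∀ i → i ≤ n → g (i · a) ≡ i · b) where
      private
        c : Fin card
        c = g (suc n · a)

        zeros→ : ∀ {k} → k ≤ n → k · a ≡ e → k · b ≡ e
        zeros→ k≤n ka≡e = trans (sym (ih _ k≤n)) (g-zero⁺ ka≡e)

        zeros← : ∀ {k} → k ≤ n → k · b ≡ e → k · a ≡ e
        zeros← k≤n kb≡e = g-zero⁻ (trans (ih _ k≤n) kb≡e)

        image : multiples b n +ᴾ pair G c ≡ multiples b n +ᴾ multiples b (suc n)
        image = begin
          multiples b n +ᴾ pair G c                    ≡⟨ cong₂ _+ᴾ_ (f-multiples a n) (f-pair _) ⟨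
          f (multiples a n) +ᴾ f (pair G (suc n · a))  ≡⟨ f-hom _ _ ⟨
          f (multiples a n +ᴾ pair G (suc n · a))      ≡⟨ cong f (multiples+pair-next a n) ⟩
          f (multiples a n +ᴾ multiples a (suc n))     ≡⟨ f-hom _ _ ⟩
          f (multiples a n) +ᴾ f (multiples a (suc n)) ≡⟨ cong₂ _+ᴾ_ (f-multiples a n) (f-multiples a (suc n)) ⟩
          multiples b n +ᴾ multiples b (suc n)         ∎
          where open ≡-Reasoning

        sucn·b∈ : suc n · b ∈ proj₁ (multiples b n +ᴾ pair G c)
        sucn·b∈ = subst (λ Z → suc n · b ∈ proj₁ Z) (sym image)
          (∈-+ᴾ⁺ (multiples b n) (multiples b (suc n)) (proj₂ (multiples b n)) (∈-multiples⁺ b (≤-refl {suc n})) (identityˡ _))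

        via-coincidence : ∀ {i} → i ≤ n → suc n · a ≡ i · a → suc n · b ≡ i · b → c ≡ suc n · b
        via-coincidence i≤n sucn·a≡ sucn·b≡ = trans (cong g sucn·a≡) (trans (ih _ i≤n) (sym sucn·b≡))

        -- The vanishing of (n + 1) · b makes Sₙ₊₁(b) = Sₙ(b), which f⁻¹ carries back to a.
        b-vanishes : suc n · b ≡ e → c ≡ suc n · b
        b-vanishes sucn·b≡e with ∈-multiples⁻ a n sucn·a∈
          where
          stable : multiples a (suc n) ≡ multiples a n
          stable = f-injective (trans (f-multiples a (suc n))
            (trans (multiples-stable b n (subst (_∈ proj₁ (multiples b n)) (sym sucn·b≡e) (∈-multiples⁺ b (z≤n {n}))))
                   (sym (f-multiples a n))))
          sucn·a∈ : suc n · a ∈ proj₁ (multiples a n)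
          sucn·a∈ = subst (λ Z → suc n · a ∈ proj₁ Z) stable (∈-multiples⁺ a (≤-refl {suc n}))
        ... | zero  , _    , sucn·a≡e = via-coincidence z≤n sucn·a≡e sucn·b≡e
        ... | suc i , si≤n , sucn·a≡  =
          via-coincidence si≤n sucn·a≡ (·-≡-transfer (m≤n⇒m≤1+n si≤n) (zeros→ (m∸n≤m n i)) sucn·a≡)

        in-multiples : ∀ j → j ≤ n → suc n · b ≡ j · b → c ≡ suc n · b
        in-multiples zero    _    sucn·b≡e = b-vanishes sucn·b≡e
        in-multiples (suc j) sj≤n sucn·b≡  =
          via-coincidence sj≤n (·-≡-transfer (m≤n⇒m≤1+n sj≤n) (zeros← (m∸n≤m n j)) sucn·b≡) sucn·b≡

        shifted : ∀ j → j ≤ n → j · b ⊕ c ≡ suc n · b → c ≡ suc n · b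
        shifted zero    _    eq = trans (sym (identityˡ c)) eq
        shifted (suc j) sj≤n eq = begin
          c            ≡⟨ c≡k·b ⟩
          k · b        ≡⟨ ·-≡-transfer (m∸n≤m (suc n) (suc j)) (zeros→ k′≤n) sucn·a≡k·a ⟨
          suc n · b    ∎
          where
          open ≡-Reasoning
          k : ℕ
          k = suc n ∸ suc j
          c≡k·b : c ≡ k · b
          c≡k·b = ∙-cancelˡ (suc j · b) _ _ (trans eq (·-split b (m≤n⇒m≤1+n sj≤n)))
          sucn·a≡k·a : suc n · a ≡ k · a
          sucn·a≡k·a = g-injective (trans c≡k·b (sym (ih k (m∸n≤m n j))))
          k′≤n : suc n ∸ k ≤ n
          k′≤n = ≤-trans (≤-reflexive (m∸[m∸n]≡n (m≤n⇒m≤1+n sj≤n))) sj≤n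

      g-·-step : g (suc n · a) ≡ suc n · b
      g-·-step with ∈-+ᴾ⁻ (multiples b n) (pair G c) sucn·b∈
      ... | u , v , u∈ , v∈ , u⊕v≡ with ∈-multiples⁻ b n u∈ | ∈-pair⁻ v∈
      ... | j , j≤n , refl | inj₁ refl = in-multiples j j≤n (trans (sym u⊕v≡) (identityʳ _))
      ... | j , j≤n , refl | inj₂ refl = shifted j j≤n u⊕v≡

    g-·-upTo : ∀ n i → i ≤ n → g (i · a) ≡ i · b
    g-·-upTo n       zero    _         = g-e
    g-·-upTo (suc n) (suc i) (s≤s i≤n) = g-·-step i (λ k k≤i → g-·-upTo n k (≤-trans k≤i i≤n))

    g-· : ∀ n → g (n · a) ≡ n · b
    g-· n = g-·-upTo n n ≤-refl

    g-·-zero⁺ : ∀ k → k · a ≡ e → k · b ≡ e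
    g-·-zero⁺ k ka≡e = trans (sym (g-· k)) (g-zero⁺ ka≡e)

    g-·-zero⁻ : ∀ k → k · b ≡ e → k · a ≡ e
    g-·-zero⁻ k kb≡e = g-zero⁻ (trans (g-· k) kb≡e)

    g-preserves-order : ∀ m → IsOrder G a m → IsOrder G b m
    g-preserves-order m = IsOrder-transfer g-·-zero⁺ g-·-zero⁻

    g-reflects-order : ∀ m → IsOrder G b m → IsOrder G a m
    g-reflects-order m = IsOrder-transfer g-·-zero⁻ g-·-zero⁺

lemma2p5 : (G : FinAbGroup) (f : P₀ G → P₀ G) → IsAutomorphism G f →
    (g : Fin (FinAbGroup.card G) → Fin (FinAbGroup.card G)) → IsPullback G f g →
    ∀ (a : Fin (FinAbGroup.card G)) → a ≢ FinAbGroup.e G →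
      (∀ m → (IsOrder G a m → IsOrder G (g a) m) × (IsOrder G (g a) m → IsOrder G a m))
      × (∀ (n : ℕ) → 0 < n → g (mul G n a) ≡ mul G n (g a))
lemma2p5 G f aut g pb a _ = (λ m → g-preserves-order a m , g-reflects-order a m) , (λ n _ → g-· a n)
  where open Pullback G f aut g pb
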